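{- Let $\mathbb{A}=(a_{i_1i_2\ldots i_m})$ be a nonnegative tensor of order $m$ and dimension $2$. If there exist $\alpha_1,\alpha_2\in[2]^{m-1}$ such that $a_{1\alpha_1}=a_{2\alpha_2}=0$, then $\mathbb{A}$ is not strongly primitive.
   Context: $[n]=\{1,\ldots,n\}$; for $i\in[n]$ and $\alpha=i_2\ldots i_m\in[n]^{m-1}$, $a_{i\alpha}=a_{ii_2\ldots i_m}$. General product: for $\mathbb{A}$ of order $m\ge2$ and $\mathbb{B}$ of order $k\ge1$, both of dimension $n$, $(\mathbb{A}\mathbb{B})_{i\alpha_1\ldots\alpha_{m-1}}=\sum_{i_2,\ldots,i_m=1}^n a_{ii_2\ldots i_m}b_{i_2\alpha_1}\cdots b_{i_m\alpha_{m-1}}$ ($\alpha_j\in[n]^{k-1}$), a tensor of order $(m-1)(k-1)+1$; it is associative, $\mathbb{A}^1=\mathbb{A}$, $\mathbb{A}^k=\mathbb{A}\mathbb{A}^{k-1}$. A nonnegative tensor $\mathbb{A}$ is strongly primitive if $\mathbb{A}^k$ is positive (all entries $>0$) for some positive integer $k$.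
   Formalization: The nonnegative tensor $\mathbb{A}$ has rational entries. -}

module Defs where

open import Data.Nat using (ℕ; zero; suc; _∸_; _^_)
import Data.Nat as ℕ
open import Data.Nat.Properties using (*-identityʳ)
open import Data.Fin using (Fin)
open import Data.Vec using (Vec; []; _∷_; take; drop; allFin; cast; zipWith)
import Data.Vec as Vec
open import Data.List using (List; []; _∷_; concatMap; map; foldr)
import Data.List as List
open import Data.Rational using (ℚ; 0ℚ; 1ℚ; _+_; _*_; _≤_; _<_)
open import Relation.Binary.PropositionalEquality using (cong)

-- A tensor of order m and dimension n: entry a_{i i₂ … i_m} is  A i (i₂ ∷ … ∷ i_m ∷ []).
-- The first index is kept separate, the remaining m-1 indices form a vector.
Tensor : ℕ → ℕ → Set
Tensor n m = Fin n → Vec (Fin n) (m ∸ 1) → ℚ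

allIdx : (n d : ℕ) → List (Vec (Fin n) d)
allIdx n zero = [] ∷ []
allIdx n (suc d) = concatMap (λ i → map (i ∷_) (allIdx n d)) (Vec.toList (allFin n))

sumℚ : List ℚ → ℚ
sumℚ = foldr _+_ 0ℚ

prodℚ : ∀ {d} → Vec ℚ d → ℚ
prodℚ = Vec.foldr′ _*_ 1ℚ

chunks : ∀ {A : Set} p q → Vec A (p ℕ.* q) → Vec (Vec A q) p
chunks zero q xs = []
chunks (suc p) q xs = take q xs ∷ chunks p q (drop q xs)

-- General product: (A B)_{i α₁ … α_{m-1}} = Σ_{i₂…i_m} a_{i i₂…i_m} b_{i₂ α₁} ⋯ b_{i_m α_{m-1}}
-- of order (m-1)(k-1)+1.
_⊙_ : ∀ {n m k} → Tensor n m → Tensor n k → Tensor n (suc ((m ∸ 1) ℕ.* (k ∸ 1)))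
_⊙_ {n} {m} {k} A B i α =
  sumℚ (map (λ v → A i v * prodℚ (zipWith B v (chunks (m ∸ 1) (k ∸ 1) α)))
            (allIdx n (m ∸ 1)))

-- pow A k = A^(suc k), of order (m-1)^(suc k) + 1;  A^1 = A,  A^(k+1) = A A^k.
pow : ∀ {n m} → Tensor n m → (k : ℕ) → Tensor n (suc ((m ∸ 1) ^ suc k))
pow {n} {m} A zero i α = A i (cast (*-identityʳ (m ∸ 1)) α)
pow {n} {m} A (suc k) = _⊙_ {n} {m} {suc ((m ∸ 1) ^ suc k)} A (pow {n} {m} A k)

Nonnegative : ∀ {n m} → Tensor n m → Set
Nonnegative {n} {m} A = ∀ (i : Fin n) (α : Vec (Fin n) (m ∸ 1)) → 0ℚ ≤ A i α

Positive : ∀ {n m} → Tensor n m → Set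
Positive {n} {m} A = ∀ (i : Fin n) (α : Vec (Fin n) (m ∸ 1)) → 0ℚ < A i α

StronglyPrimitive : ∀ {n m} → Tensor n m → Set
StronglyPrimitive {n} {m} A = Σ ℕ (λ j → Positive {n} {suc ((m ∸ 1) ^ suc j)} (pow {n} {m} A j))
  where open import Data.Product using (Σ)

{-# OPTIONS --safe #-}
-- Call a tensor row-deficient if each row i has a zero entry a_{i α_i}. In dimension 2
-- this is preserved by the general product: for B row-deficient with zeros at β_c, the
-- entry of AB at (i, β_{ā_1} … β_{ā_{m-1}}), where α_i = a_1 … a_{m-1} and ā is the other
-- index, vanishes term by term. The summand for i₂…i_m = α_i contains a_{i α_i} = 0, and any
-- other summand has some i_j = ā_j, hence the factor b_{ā_j β_{ā_j}} = 0. So every power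
-- A^k is row-deficient, and none is positive.
module Submission where

open import Defs
open import Data.Nat using (ℕ; _≤_; _∸_)
import Data.Nat as ℕ
open import Data.Nat.Properties using (*-identityʳ)
open import Data.Fin using (Fin; zero; suc; opposite; _≟_)
open import Data.Vec using (Vec; []; _∷_; _++_; concat; zipWith; cast; map)
open import Data.Vec.Properties using (take++drop≡id; ++-injectiveˡ; ++-injectiveʳ; cast-sym)
open import Data.List using (List; []; _∷_)
import Data.List as List
open import Data.Rational using (ℚ; 0ℚ; _*_; _+_)
open import Data.Rational.Properties using (*-zeroˡ; *-zeroʳ; +-identityˡ; <-irrefl)
open import Data.Product using (∃-syntax; _,_; proj₁; proj₂)
open import Data.Sum using (_⊎_; inj₁; inj₂)
open import Relation.Binary.PropositionalEquality using (_≡_; _≢_; refl; sym; trans; cong; cong₂)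
open import Relation.Nullary using (¬_; yes; no; contradiction)

RowDeficient : ∀ {n d} → (Fin n → Vec (Fin n) d → ℚ) → Set
RowDeficient A = ∀ i → ∃[ α ] A i α ≡ 0ℚ

≢⇒≡opposite : {x y : Fin 2} → x ≢ y → x ≡ opposite y
≢⇒≡opposite {zero}     {zero}     x≢y = contradiction refl x≢y
≢⇒≡opposite {zero}     {suc zero} _   = refl
≢⇒≡opposite {suc zero} {zero}     _   = refl
≢⇒≡opposite {suc zero} {suc zero} x≢y = contradiction refl x≢y

chunks-concat : ∀ {A : Set} p q (xss : Vec (Vec A q) p) → chunks p q (concat xss) ≡ xss
chunks-concat ℕ.zero    q []         = refl
chunks-concat (ℕ.suc p) q (xs ∷ xss) =
  cong₂ _∷_ (++-injectiveˡ _ xs split)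
            (trans (cong (chunks p q) (++-injectiveʳ _ xs split)) (chunks-concat p q xss))
  where split = take++drop≡id q (xs ++ concat xss)

sumℚ-map-≡0 : ∀ {X : Set} (f : X → ℚ) → (∀ x → f x ≡ 0ℚ) → (xs : List X) →
              sumℚ (List.map f xs) ≡ 0ℚ
sumℚ-map-≡0 f f≡0 []       = refl
sumℚ-map-≡0 f f≡0 (x ∷ xs) =
  trans (cong₂ _+_ (f≡0 x) (sumℚ-map-≡0 f f≡0 xs)) (+-identityˡ 0ℚ)

x≡0⇒x*y≡0 : ∀ {x} y → x ≡ 0ℚ → x * y ≡ 0ℚ
x≡0⇒x*y≡0 y refl = *-zeroˡ y

y≡0⇒x*y≡0 : ∀ x {y} → y ≡ 0ℚ → x * y ≡ 0ℚ
y≡0⇒x*y≡0 x refl = *-zeroʳ x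

module _ {d} {B : Fin 2 → Vec (Fin 2) d → ℚ} (zB : RowDeficient B) where

  avoiding : ∀ {e} → Vec (Fin 2) e → Vec (Vec (Fin 2) d) e
  avoiding = map (λ a → proj₁ (zB (opposite a)))

  B-avoiding≡0 : {x a : Fin 2} → x ≢ a → B x (proj₁ (zB (opposite a))) ≡ 0ℚ
  B-avoiding≡0 {x} x≢a rewrite sym (≢⇒≡opposite x≢a) = proj₂ (zB x)

  prodℚ-avoiding : ∀ {e} (v α : Vec (Fin 2) e) →
                   v ≡ α ⊎ prodℚ (zipWith B v (avoiding α)) ≡ 0ℚ
  prodℚ-avoiding []      []      = inj₁ refl
  prodℚ-avoiding (x ∷ v) (a ∷ α) with x ≟ a | prodℚ-avoiding v α
  ... | yes refl | inj₁ refl   = inj₁ refl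
  ... | yes refl | inj₂ rest≡0 = inj₂ (y≡0⇒x*y≡0 (B x _) rest≡0)
  ... | no x≢a   | _           = inj₂ (x≡0⇒x*y≡0 _ (B-avoiding≡0 x≢a))

⊙-rowDeficient : ∀ {m k} (A : Tensor 2 m) (B : Tensor 2 k) →
                 RowDeficient A → RowDeficient B → RowDeficient (_⊙_ {2} {m} {k} A B)
⊙-rowDeficient {m} {k} A B zA zB i with zA i
... | α , Aα≡0 = concat (avoiding zB α) , sumℚ-map-≡0 _ summand≡0 (allIdx 2 (m ∸ 1))
  where
  summand≡0 : ∀ v → A i v * prodℚ (zipWith B v (chunks (m ∸ 1) (k ∸ 1) (concat (avoiding zB α))))
                    ≡ 0ℚ
  summand≡0 v rewrite chunks-concat (m ∸ 1) (k ∸ 1) (avoiding zB α) with prodℚ-avoiding zB v α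
  ... | inj₁ refl   = x≡0⇒x*y≡0 _ Aα≡0
  ... | inj₂ prod≡0 = y≡0⇒x*y≡0 (A i v) prod≡0

pow-rowDeficient : ∀ {m} (A : Tensor 2 m) → RowDeficient A →
                   ∀ j → RowDeficient (pow {2} {m} A j)
pow-rowDeficient {m} A zA ℕ.zero i with zA i
... | α , Aα≡0 = cast (sym eq) α , trans (cong (A i) (cast-sym (sym eq) refl)) Aα≡0
  where eq = *-identityʳ (m ∸ 1)
pow-rowDeficient {m} A zA (ℕ.suc j) =
  ⊙-rowDeficient {m} {ℕ.suc ((m ∸ 1) ℕ.^ ℕ.suc j)} A (pow {2} {m} A j)
                 zA (pow-rowDeficient {m} A zA j)

theorem3p7 : (m : ℕ) → 2 ≤ m → (A : Tensor 2 m) → Nonnegative {2} {m} A →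
    (α₁ α₂ : Vec (Fin 2) (m ∸ 1)) → A zero α₁ ≡ 0ℚ → A (suc zero) α₂ ≡ 0ℚ →
    ¬ StronglyPrimitive {2} {m} A
theorem3p7 m _ A _ α₁ α₂ A₁α₁≡0 A₂α₂≡0 (j , positive) =
  let (α , Aʲα≡0) = pow-rowDeficient {m} A zA j zero
  in  <-irrefl (sym Aʲα≡0) (positive zero α)
  where
  zA : RowDeficient A
  zA zero       = α₁ , A₁α₁≡0
  zA (suc zero) = α₂ , A₂α₂≡0
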